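{- There is an absolute constant $c>0$ such that the following holds. Let $H$ be an $n$-vertex, $m$-edge $3$-uniform multihypergraph and let $U\subseteq V(H)$ with $|U|=n-b$. Then either $e(H[U])\ge cm$, or $b>0$ and $H$ has a $3$-cut with excess at least $cm/b$.
   Context: A $3$-uniform multihypergraph has a vertex set and a multiset of $3$-element vertex subsets (edges). $H[U]$ is the induced subhypergraph on $U$ and $e(\cdot)$ counts edges with multiplicity. A $3$-cut is a partition of $V(H)$ into three labelled parts; its size is the number of edges having a vertex in each of the three parts; its excess is its size minus $\frac{6}{27}m$, the expected size of a uniformly random $3$-cut. -}

module Defs where

open import Data.Nat using (ℕ; zero; suc; _+_; _*_)
open import Data.Fin using (Fin; _<_; _≟_)
open import Data.Fin.Subset using (Subset; _∈_)
open import Data.Fin.Subset.Properties using (_∈?_)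
open import Data.Product using (Σ; _×_; _,_; proj₁)
open import Data.List using (List; length; filter)
open import Relation.Binary.PropositionalEquality using (_≡_)
open import Data.Rational using (ℚ)
import Data.Rational as ℚ
open import Data.Integer using (+_)
open import Relation.Nullary using (¬_; Dec; yes; no)
open import Relation.Nullary.Decidable using (_×-dec_; ¬?)

record Edge (n : ℕ) : Set where
  constructor edge
  field
    v₁ v₂ v₃ : Fin n
    v₁<v₂ : v₁ < v₂
    v₂<v₃ : v₂ < v₃

open Edge public

-- A 3-uniform multihypergraph on vertex set Fin n: a finite multiset
-- (list, order irrelevant) of 3-element vertex subsets.
Hypergraph : ℕ → Set
Hypergraph n = List (Edge n)

e : ∀ {n} → Hypergraph n → ℕ
e H = length H

induced : ∀ {n} → Hypergraph n → Subset n → Hypergraph n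
induced H U = filter (λ f → (v₁ f ∈? U) ×-dec ((v₂ f ∈? U) ×-dec (v₃ f ∈? U))) H

Cut3 : ℕ → Set
Cut3 n = Fin n → Fin 3

-- an edge is cut iff it has a vertex in each of the three parts,
-- i.e. its three vertices receive pairwise distinct labels
isCut? : ∀ {n} (φ : Cut3 n) (f : Edge n) →
  Dec ((¬ φ (v₁ f) ≡ φ (v₂ f)) × ((¬ φ (v₂ f) ≡ φ (v₃ f)) × (¬ φ (v₁ f) ≡ φ (v₃ f))))
isCut? φ f = ¬? (φ (v₁ f) ≟ φ (v₂ f)) ×-dec (¬? (φ (v₂ f) ≟ φ (v₃ f)) ×-dec ¬? (φ (v₁ f) ≟ φ (v₃ f)))

cutSize : ∀ {n} → Hypergraph n → Cut3 n → ℕ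
cutSize H φ = length (filter (isCut? φ) H)

toℚ : ℕ → ℚ
toℚ k = + k ℚ./ 1

excess : ∀ {n} → Hypergraph n → Cut3 n → ℚ
excess H φ = toℚ (cutSize H φ) ℚ.- ((+ (6 * e H)) ℚ./ 27)

-- If fewer than m/40 edges lie inside U, then b ≥ 1 and either at least half of the edges have
-- exactly one vertex outside U, or more than 19/40 of them have at least two.  In the first case
-- colour U randomly with colours 1 and 2 and the other vertices with 0: each such edge is cut with
-- probability 1/2, so some cut has size at least m/4 = 6m/27 + m/36.  In the second case colour all
-- vertices uniformly and independently, except that for a random t < 2b the outside vertices of
-- ranks r and t − r take two distinct colours.  An edge whose two outside vertices are coupled is
-- cut with probability 1/3 instead of 2/9, and each pair of outside vertices is coupled for exactly
-- one t, so the expected excess is at least m₂/(18b) ≥ m/(40b).  All random choices are seeds in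
-- Fin 6, expectations are exact sums over all seeds, and averaging turns them into a concrete cut.

module Submission where

open import Defs

module Averaging where

  open import Agda.Builtin.Int using (pos)
  open import Data.Bool using (Bool; true; false; not; _∧_)
  open import Data.Bool.Properties using (¬-not)
  open import Data.Fin using (Fin; zero; suc; toℕ; _≟_)
  import Data.Fin as Fin
  import Data.Fin.Properties as FinP
  open import Data.Fin.Patterns using (0F; 1F; 2F; 3F; 4F; 5F)
  open import Data.Fin.Subset using (Subset; _∈_; _∉_; ∁; ∣_∣)
  open import Data.Fin.Subset.Properties using (_∈?_; ∣p∣≤n; ∣∁p∣≡n∸∣p∣)
  import Data.Integer as ℤ
  import Data.Integer.Properties as ℤP
  open import Data.Integer.Tactic.RingSolver using () renaming (solve-∀ to ℤ-solve-∀)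
  open import Data.List using ([]; _∷_; length; filter)
  open import Data.List.Properties using (filter-all)
  import Data.List.Relation.Unary.All as All
  open import Data.Nat using (ℕ; zero; suc; _+_; _*_; _∸_; _^_; _≤_; _<_; z≤n; s≤s; _≤?_; _<?_)
  open import Data.Nat.Properties as ℕ
    using (+-*-semiring; ≤-refl; ≤-trans; +-mono-≤; *-monoʳ-≤; ≰⇒>; +-cancelˡ-≤; +-identityʳ)
  open import Data.Nat.Tactic.RingSolver using (solve-∀)
  open import Data.Product using (∃; _×_; _,_; proj₁; proj₂)
  import Data.Product as Product
  open import Data.Rational using (ℚ)
  import Data.Rational as ℚ
  import Data.Rational.Properties as ℚP
  open import Data.Rational.Unnormalised using (mkℚᵘ; *≤*; _≃_)
  import Data.Rational.Unnormalised as ℚᵘ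
  import Data.Rational.Unnormalised.Properties as ℚᵘP
  open import Data.Sum using (_⊎_; inj₁; inj₂)
  open import Data.Vec using (Vec; []; _∷_; lookup; _[_]≔_; here; there)
  open import Data.Vec.Properties using (lookup∘updateAt; lookup∘updateAt′)
  open import Function using (_∘_)
  open import Level using (0ℓ)
  open import Relation.Binary using (tri<; tri≈; tri>)
  open import Relation.Binary.PropositionalEquality
  open import Relation.Nullary using (¬_; Dec; does; yes; no; contradiction)
  open import Relation.Nullary.Decidable using (_×-dec_; ¬?)
  open import Relation.Unary using (Pred; Decidable)
  open import Algebra.Properties.Semiring.Sum +-*-semiring
    using (sum-syntax; sum-cong-≗; ∑-distrib-+; ∑-comm; *-distribˡ-sum)

  -- Sums over Fin and over seed vectors

  ∑-const : ∀ k c → ∑[ i < k ] c ≡ k * c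
  ∑-const zero    c = refl
  ∑-const (suc k) c = cong (c +_) (∑-const k c)

  ∑-mono-≤ : ∀ {k} {f g : Fin k → ℕ} → (∀ i → f i ≤ g i) → ∑[ i < k ] f i ≤ ∑[ i < k ] g i
  ∑-mono-≤ {zero}  f≤g = z≤n
  ∑-mono-≤ {suc k} f≤g = +-mono-≤ (f≤g zero) (∑-mono-≤ (f≤g ∘ suc))

  ∑-average : ∀ {k} (f : Fin (suc k) → ℕ) {y} → suc k * y ≤ ∑[ i < suc k ] f i → ∃ λ i → y ≤ f i
  ∑-average f {y} k*y≤∑ with y ≤? f zero
  ... | yes y≤f₀ = zero , y≤f₀
  ∑-average {zero}  f {y} k*y≤∑ | no y≰f₀ =
    contradiction (subst₂ _≤_ (+-identityʳ y) (+-identityʳ (f zero)) k*y≤∑) y≰f₀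
  ∑-average {suc k} f {y} k*y≤∑ | no y≰f₀ =
    Product.map suc (λ y≤f → y≤f) (∑-average (f ∘ suc) (+-cancelˡ-≤ (f zero) _ _ f₀+k*y≤∑))
    where
    f₀+k*y≤∑ : f zero + suc k * y ≤ f zero + ∑[ i < suc k ] f (suc i)
    f₀+k*y≤∑ = ≤-trans (+-mono-≤ (ℕ.<⇒≤ (≰⇒> y≰f₀)) ≤-refl) k*y≤∑

  ∑-≥ : ∀ {k} {g : Fin k → ℕ} {a} → (∀ i → a ≤ g i) → k * a ≤ ∑[ i < k ] g i
  ∑-≥ {k} {g} {a} a≤g = subst (_≤ ∑[ i < k ] g i) (∑-const k a) (∑-mono-≤ a≤g)

  ∑-≥-bump : ∀ {k} {g : Fin k → ℕ} {a d} (i : Fin k) → (∀ j → a ≤ g j) → a + d ≤ g i → k * a + d ≤ ∑[ j < k ] g j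
  ∑-≥-bump {suc k} {g} {a} {d} zero a≤g a+d≤gᵢ = begin
    a + k * a + d             ≡⟨ regroup a (k * a) d ⟩
    (a + d) + k * a           ≤⟨ +-mono-≤ a+d≤gᵢ (∑-≥ (a≤g ∘ suc)) ⟩
    g zero + ∑[ j < k ] g (suc j) ∎
    where
    open ℕ.≤-Reasoning
    regroup : ∀ a b d → a + b + d ≡ (a + d) + b
    regroup = solve-∀
  ∑-≥-bump {suc k} {g} {a} {d} (suc i) a≤g a+d≤gᵢ = begin
    a + k * a + d             ≡⟨ ℕ.+-assoc a (k * a) d ⟩
    a + (k * a + d)           ≤⟨ +-mono-≤ (a≤g zero) (∑-≥-bump i (a≤g ∘ suc) a+d≤gᵢ) ⟩
    g zero + ∑[ j < k ] g (suc j) ∎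
    where open ℕ.≤-Reasoning

  ∑ᵛ : ∀ {k} L → (Vec (Fin k) L → ℕ) → ℕ
  ∑ᵛ {k} zero    F = F []
  ∑ᵛ {k} (suc L) F = ∑[ a < k ] ∑ᵛ L (λ σ → F (a ∷ σ))

  module _ {k : ℕ} where

    ∑ᵛ-cong : ∀ L {F G : Vec (Fin k) L → ℕ} → (∀ σ → F σ ≡ G σ) → ∑ᵛ L F ≡ ∑ᵛ L G
    ∑ᵛ-cong zero    F≗G = F≗G []
    ∑ᵛ-cong (suc L) F≗G = sum-cong-≗ {k} (λ a → ∑ᵛ-cong L (F≗G ∘ (a ∷_)))

    ∑ᵛ-const : ∀ L c → ∑ᵛ L (λ (_ : Vec (Fin k) L) → c) ≡ k ^ L * c
    ∑ᵛ-const zero    c = sym (+-identityʳ c)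
    ∑ᵛ-const (suc L) c = begin
      ∑[ a < k ] ∑ᵛ L (λ _ → c) ≡⟨ sum-cong-≗ {k} (λ _ → ∑ᵛ-const L c) ⟩
      ∑[ a < k ] (k ^ L * c)    ≡⟨ ∑-const k (k ^ L * c) ⟩
      k * (k ^ L * c)           ≡⟨ sym (ℕ.*-assoc k (k ^ L) c) ⟩
      k ^ suc L * c             ∎
      where open ≡-Reasoning

    ∑ᵛ-distrib-+ : ∀ L (F G : Vec (Fin k) L → ℕ) → ∑ᵛ L (λ σ → F σ + G σ) ≡ ∑ᵛ L F + ∑ᵛ L G
    ∑ᵛ-distrib-+ zero    F G = refl
    ∑ᵛ-distrib-+ (suc L) F G = trans (sum-cong-≗ {k} (λ a → ∑ᵛ-distrib-+ L (F ∘ (a ∷_)) (G ∘ (a ∷_))))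
                                     (∑-distrib-+ (λ a → ∑ᵛ L (F ∘ (a ∷_))) (λ a → ∑ᵛ L (G ∘ (a ∷_))))

    *-distribˡ-∑ᵛ : ∀ L c (F : Vec (Fin k) L → ℕ) → c * ∑ᵛ L F ≡ ∑ᵛ L (λ σ → c * F σ)
    *-distribˡ-∑ᵛ zero    c F = refl
    *-distribˡ-∑ᵛ (suc L) c F = trans (*-distribˡ-sum c (λ a → ∑ᵛ L (F ∘ (a ∷_))))
                                      (sum-cong-≗ {k} (λ a → *-distribˡ-∑ᵛ L c (F ∘ (a ∷_))))

    ∑ᵛ-comm-∑ : ∀ L {m} (F : Fin m → Vec (Fin k) L → ℕ) →
                ∑ᵛ L (λ σ → ∑[ i < m ] F i σ) ≡ ∑[ i < m ] ∑ᵛ L (F i)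
    ∑ᵛ-comm-∑ zero    F = refl
    ∑ᵛ-comm-∑ (suc L) {m} F = trans (sum-cong-≗ {k} (λ a → ∑ᵛ-comm-∑ L (λ i σ → F i (a ∷ σ))))
                                    (∑-comm {k} {m} (λ a i → ∑ᵛ L (F i ∘ (a ∷_))))

  ∑ᵛ-average : ∀ {k} L (F : Vec (Fin (suc k)) L → ℕ) {y} → suc k ^ L * y ≤ ∑ᵛ L F → ∃ λ σ → y ≤ F σ
  ∑ᵛ-average zero    F {y} y≤F = [] , subst (_≤ F []) (+-identityʳ y) y≤F
  ∑ᵛ-average {k} (suc L) F {y} k^L*y≤∑ with ∑-average _ (subst (_≤ ∑ᵛ (suc L) F) (ℕ.*-assoc (suc k) (suc k ^ L) y) k^L*y≤∑)
  ... | a , ≤∑a with ∑ᵛ-average L (F ∘ (a ∷_)) ≤∑a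
  ...   | σ , y≤F = a ∷ σ , y≤F

  module _ {k : ℕ} where

    ∑ᵛ-resample : ∀ {L} (c : Fin L) (F : Vec (Fin k) L → ℕ) →
                  k * ∑ᵛ L F ≡ ∑ᵛ L (λ σ → ∑[ a < k ] F (σ [ c ]≔ a))
    ∑ᵛ-resample {suc L} zero    F = begin
      k * ∑[ a < k ] ∑ᵛ L (F ∘ (a ∷_))               ≡⟨ sym (∑-const k _) ⟩
      ∑[ _ < k ] ∑[ a < k ] ∑ᵛ L (F ∘ (a ∷_))        ≡⟨ sum-cong-≗ {k} (λ _ → sym (∑ᵛ-comm-∑ L (λ a → F ∘ (a ∷_)))) ⟩
      ∑[ _ < k ] ∑ᵛ L (λ σ → ∑[ a < k ] F (a ∷ σ))  ∎
      where open ≡-Reasoning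
    ∑ᵛ-resample {suc L} (suc c) F =
      trans (*-distribˡ-sum k (λ a → ∑ᵛ L (F ∘ (a ∷_)))) (sum-cong-≗ {k} (λ a → ∑ᵛ-resample c (F ∘ (a ∷_))))

    marginal₁ : ∀ {L} (c : Fin L) (g : Fin k → ℕ) →
                k * ∑ᵛ L (λ σ → g (lookup σ c)) ≡ k ^ L * ∑[ x < k ] g x
    marginal₁ {L} c g = begin
      k * ∑ᵛ L (λ σ → g (lookup σ c))                    ≡⟨ ∑ᵛ-resample c _ ⟩
      ∑ᵛ L (λ σ → ∑[ x < k ] g (lookup (σ [ c ]≔ x) c))
        ≡⟨ ∑ᵛ-cong L (λ σ → sum-cong-≗ {k} (λ x → cong g (lookup∘updateAt c σ))) ⟩
      ∑ᵛ L (λ σ → ∑[ x < k ] g x)                        ≡⟨ ∑ᵛ-const L _ ⟩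
      k ^ L * ∑[ x < k ] g x                             ∎
      where open ≡-Reasoning

    marginal₂ : ∀ {L} {c c′ : Fin L} → c ≢ c′ → (g : Fin k → Fin k → ℕ) →
                k * (k * ∑ᵛ L (λ σ → g (lookup σ c) (lookup σ c′))) ≡ k ^ L * ∑[ y < k ] ∑[ x < k ] g x y
    marginal₂ {L} {c} {c′} c≢c′ g = begin
      k * (k * ∑ᵛ L (λ σ → g (lookup σ c) (lookup σ c′)))  ≡⟨ cong (k *_) (∑ᵛ-resample c _) ⟩
      k * ∑ᵛ L (λ σ → ∑[ x < k ] g (lookup (σ [ c ]≔ x) c) (lookup (σ [ c ]≔ x) c′))
        ≡⟨ cong (k *_) (∑ᵛ-cong L (λ σ → sum-cong-≗ {k} (λ x →
             cong₂ g (lookup∘updateAt c σ) (lookup∘updateAt′ c′ c (c≢c′ ∘ sym) σ)))) ⟩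
      k * ∑ᵛ L (λ σ → ∑[ x < k ] g x (lookup σ c′))       ≡⟨ marginal₁ c′ _ ⟩
      k ^ L * ∑[ y < k ] ∑[ x < k ] g x y                  ∎
      where open ≡-Reasoning

    marginal₃ : ∀ {L} {c₁ c₂ c₃ : Fin L} → c₁ ≢ c₂ → c₁ ≢ c₃ → c₂ ≢ c₃ → (g : Fin k → Fin k → Fin k → ℕ) →
                k * (k * (k * ∑ᵛ L (λ σ → g (lookup σ c₁) (lookup σ c₂) (lookup σ c₃))))
                  ≡ k ^ L * ∑[ z < k ] ∑[ y < k ] ∑[ x < k ] g x y z
    marginal₃ {L} {c₁} {c₂} {c₃} c₁≢c₂ c₁≢c₃ c₂≢c₃ g = begin
      k * (k * (k * ∑ᵛ L (λ σ → g (lookup σ c₁) (lookup σ c₂) (lookup σ c₃))))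
        ≡⟨ cong (λ w → k * (k * w)) (∑ᵛ-resample c₁ _) ⟩
      k * (k * ∑ᵛ L (λ σ → ∑[ x < k ] g (lookup (σ [ c₁ ]≔ x) c₁) (lookup (σ [ c₁ ]≔ x) c₂) (lookup (σ [ c₁ ]≔ x) c₃)))
        ≡⟨ cong (λ w → k * (k * w)) (∑ᵛ-cong L (λ σ → sum-cong-≗ {k} (λ x →
             trans (cong₂ (λ u → g u (lookup (σ [ c₁ ]≔ x) c₂)) (lookup∘updateAt c₁ σ)
                                                                  (lookup∘updateAt′ c₃ c₁ (c₁≢c₃ ∘ sym) σ))
                   (cong (λ v → g x v (lookup σ c₃)) (lookup∘updateAt′ c₂ c₁ (c₁≢c₂ ∘ sym) σ))))) ⟩
      k * (k * ∑ᵛ L (λ σ → ∑[ x < k ] g x (lookup σ c₂) (lookup σ c₃)))  ≡⟨ marginal₂ c₂≢c₃ _ ⟩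
      k ^ L * ∑[ z < k ] ∑[ y < k ] ∑[ x < k ] g x y z                   ∎
      where open ≡-Reasoning

  -- Seeded colourings and the first moment

  𝟙 : Bool → ℕ
  𝟙 true  = 1
  𝟙 false = 0

  length-filter-∷ : ∀ {A : Set} {P : Pred A 0ℓ} (P? : Decidable P) x xs →
                    length (filter P? (x ∷ xs)) ≡ 𝟙 (does (P? x)) + length (filter P? xs)
  length-filter-∷ P? x xs with does (P? x)
  ... | true  = refl
  ... | false = refl

  module _ {n T L k : ℕ} (φ : Fin T → Vec (Fin k) L → Cut3 n) where

    cutCount : Edge n → ℕ
    cutCount f = ∑[ t < T ] ∑ᵛ L (λ σ → 𝟙 (does (isCut? (φ t σ) f)))

    totalCutSize : Hypergraph n → ℕ
    totalCutSize H = ∑[ t < T ] ∑ᵛ L (λ σ → cutSize H (φ t σ))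

    totalCutSize-∷ : ∀ f H → totalCutSize (f ∷ H) ≡ cutCount f + totalCutSize H
    totalCutSize-∷ f H = begin
      ∑[ t < T ] ∑ᵛ L (λ σ → cutSize (f ∷ H) (φ t σ))
        ≡⟨ sum-cong-≗ {T} (λ t → ∑ᵛ-cong L (λ σ → length-filter-∷ (isCut? (φ t σ)) f H)) ⟩
      ∑[ t < T ] ∑ᵛ L (λ σ → 𝟙 (does (isCut? (φ t σ) f)) + cutSize H (φ t σ))
        ≡⟨ sum-cong-≗ {T} (λ t → ∑ᵛ-distrib-+ L _ _) ⟩
      ∑[ t < T ] (∑ᵛ L (λ σ → 𝟙 (does (isCut? (φ t σ) f))) + ∑ᵛ L (λ σ → cutSize H (φ t σ)))
        ≡⟨ ∑-distrib-+ (λ t → ∑ᵛ L (λ σ → 𝟙 (does (isCut? (φ t σ) f)))) (λ t → ∑ᵛ L (λ σ → cutSize H (φ t σ))) ⟩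
      cutCount f + totalCutSize H ∎
      where open ≡-Reasoning

    first-moment : ∀ {P : Pred (Edge n) 0ℓ} (P? : Decidable P) p q d →
                   (∀ f → p + q * 𝟙 (does (P? f)) ≤ d * cutCount f) →
                   ∀ H → p * e H + q * length (filter P? H) ≤ d * totalCutSize H
    first-moment P? p q d bound [] = subst (_≤ d * totalCutSize []) (cong₂ _+_ (sym (ℕ.*-zeroʳ p)) (sym (ℕ.*-zeroʳ q))) z≤n
    first-moment P? p q d bound (f ∷ H) = begin
      p * suc (e H) + q * length (filter P? (f ∷ H))
        ≡⟨ cong (λ c → p * suc (e H) + q * c) (length-filter-∷ P? f H) ⟩
      p * suc (e H) + q * (𝟙 (does (P? f)) + length (filter P? H))
        ≡⟨ regroup p q (e H) (𝟙 (does (P? f))) (length (filter P? H)) ⟩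
      (p + q * 𝟙 (does (P? f))) + (p * e H + q * length (filter P? H))
        ≤⟨ +-mono-≤ (bound f) (first-moment P? p q d bound H) ⟩
      d * cutCount f + d * totalCutSize H
        ≡⟨ sym (ℕ.*-distribˡ-+ d (cutCount f) (totalCutSize H)) ⟩
      d * (cutCount f + totalCutSize H)
        ≡⟨ cong (d *_) (sym (totalCutSize-∷ f H)) ⟩
      d * totalCutSize (f ∷ H) ∎
      where
      open ℕ.≤-Reasoning
      regroup : ∀ p q m a c → p * suc m + q * (a + c) ≡ (p + q * a) + (p * m + q * c)
      regroup = solve-∀

  cut-≥-average : ∀ {n T L k} (φ : Fin (suc T) → Vec (Fin (suc k)) L → Cut3 n) H d {y} →
              suc T * suc k ^ L * y ≤ d * totalCutSize φ H → ∃ λ (ψ : Cut3 n) → y ≤ d * cutSize H ψ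
  cut-≥-average {T = T} {L} {k} φ H d {y} y≤∑ with ∑-average _ (begin
      suc T * (suc k ^ L * y)                                 ≡⟨ sym (ℕ.*-assoc (suc T) (suc k ^ L) y) ⟩
      suc T * suc k ^ L * y                                   ≤⟨ y≤∑ ⟩
      d * totalCutSize φ H                                    ≡⟨ *-distribˡ-sum d (λ t → ∑ᵛ L (λ σ → cutSize H (φ t σ))) ⟩
      ∑[ t < suc T ] (d * ∑ᵛ L (λ σ → cutSize H (φ t σ)))     ≡⟨ sum-cong-≗ {suc T} (λ t → *-distribˡ-∑ᵛ L d (λ σ → cutSize H (φ t σ))) ⟩
      ∑[ t < suc T ] ∑ᵛ L (λ σ → d * cutSize H (φ t σ))       ∎)
    where open ℕ.≤-Reasoning
  ... | t , ≤∑ₜ = Product.map (φ t) (λ y≤ → y≤) (∑ᵛ-average L (λ σ → d * cutSize H (φ t σ)) ≤∑ₜ)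

  -- On the colours of the vertices of an edge this is definitionally the indicator 𝟙 (does (isCut? φ f)).
  allDistinct : Fin 3 → Fin 3 → Fin 3 → ℕ
  allDistinct x y z = 𝟙 (does (¬? (x ≟ y) ×-dec (¬? (y ≟ z) ×-dec ¬? (x ≟ z))))

  seeded : ∀ {n L} → (Fin n → Fin 6 → Fin 3) → (Fin n → Fin L) → Vec (Fin 6) L → Cut3 n
  seeded ρ κ σ v = ρ v (lookup σ (κ v))

  module _ {n L : ℕ} (ρ : Fin n → Fin 6 → Fin 3) (κ : Fin n → Fin L) where

    seedCount : Edge n → ℕ
    seedCount f = ∑ᵛ L (λ σ → 𝟙 (does (isCut? (seeded ρ κ σ) f)))

    seedCount-distinct : ∀ f → κ (v₁ f) ≢ κ (v₂ f) → κ (v₁ f) ≢ κ (v₃ f) → κ (v₂ f) ≢ κ (v₃ f) →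
      216 * seedCount f ≡ 6 ^ L * ∑[ z < 6 ] ∑[ y < 6 ] ∑[ x < 6 ] allDistinct (ρ (v₁ f) x) (ρ (v₂ f) y) (ρ (v₃ f) z)
    seedCount-distinct f κ₁≢κ₂ κ₁≢κ₃ κ₂≢κ₃ =
      trans (216* (seedCount f))
            (marginal₃ κ₁≢κ₂ κ₁≢κ₃ κ₂≢κ₃ (λ x y z → allDistinct (ρ (v₁ f) x) (ρ (v₂ f) y) (ρ (v₃ f) z)))
      where
      216* : ∀ w → 216 * w ≡ 6 * (6 * (6 * w))
      216* = solve-∀

    seedCount-shared₁₂ : ∀ f → κ (v₁ f) ≡ κ (v₂ f) → κ (v₁ f) ≢ κ (v₃ f) →
      6 * (6 * seedCount f) ≡ 6 ^ L * ∑[ z < 6 ] ∑[ x < 6 ] allDistinct (ρ (v₁ f) x) (ρ (v₂ f) x) (ρ (v₃ f) z)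
    seedCount-shared₁₂ f κ₁≡κ₂ κ₁≢κ₃ =
      trans (cong (λ c → 6 * (6 * ∑ᵛ L (λ σ → allDistinct (ρ (v₁ f) (lookup σ (κ (v₁ f)))) (ρ (v₂ f) (lookup σ c))
                                                           (ρ (v₃ f) (lookup σ (κ (v₃ f))))))) (sym κ₁≡κ₂))
            (marginal₂ κ₁≢κ₃ (λ x z → allDistinct (ρ (v₁ f) x) (ρ (v₂ f) x) (ρ (v₃ f) z)))

    seedCount-shared₁₃ : ∀ f → κ (v₁ f) ≡ κ (v₃ f) → κ (v₁ f) ≢ κ (v₂ f) →
      6 * (6 * seedCount f) ≡ 6 ^ L * ∑[ y < 6 ] ∑[ x < 6 ] allDistinct (ρ (v₁ f) x) (ρ (v₂ f) y) (ρ (v₃ f) x)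
    seedCount-shared₁₃ f κ₁≡κ₃ κ₁≢κ₂ =
      trans (cong (λ c → 6 * (6 * ∑ᵛ L (λ σ → allDistinct (ρ (v₁ f) (lookup σ (κ (v₁ f)))) (ρ (v₂ f) (lookup σ (κ (v₂ f))))
                                                           (ρ (v₃ f) (lookup σ c))))) (sym κ₁≡κ₃))
            (marginal₂ κ₁≢κ₂ (λ x y → allDistinct (ρ (v₁ f) x) (ρ (v₂ f) y) (ρ (v₃ f) x)))

    seedCount-shared₂₃ : ∀ f → κ (v₂ f) ≡ κ (v₃ f) → κ (v₁ f) ≢ κ (v₂ f) →
      6 * (6 * seedCount f) ≡ 6 ^ L * ∑[ y < 6 ] ∑[ x < 6 ] allDistinct (ρ (v₁ f) x) (ρ (v₂ f) y) (ρ (v₃ f) y)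
    seedCount-shared₂₃ f κ₂≡κ₃ κ₁≢κ₂ =
      trans (cong (λ c → 6 * (6 * ∑ᵛ L (λ σ → allDistinct (ρ (v₁ f) (lookup σ (κ (v₁ f)))) (ρ (v₂ f) (lookup σ (κ (v₂ f))))
                                                           (ρ (v₃ f) (lookup σ c))))) (sym κ₂≡κ₃))
            (marginal₂ κ₁≢κ₂ (λ x y → allDistinct (ρ (v₁ f) x) (ρ (v₂ f) y) (ρ (v₃ f) y)))

  -- A seed a : Fin 6 stands for the ordered pair (lowColour a , highColour a) of distinct
  -- colours; each of the six such pairs occurs exactly once.
  lowColour highColour : Fin 6 → Fin 3
  lowColour 0F = 0F
  lowColour 1F = 1F
  lowColour 2F = 2F
  lowColour 3F = 0F
  lowColour 4F = 1F
  lowColour 5F = 2F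
  highColour 0F = 1F
  highColour 1F = 2F
  highColour 2F = 0F
  highColour 3F = 2F
  highColour 4F = 0F
  highColour 5F = 1F

  pairedColour : Bool → Fin 6 → Fin 3
  pairedColour false = lowColour
  pairedColour true  = highColour

  allDistinct-independent : ∀ h₁ h₂ h₃ →
    ∑[ z < 6 ] ∑[ y < 6 ] ∑[ x < 6 ] allDistinct (pairedColour h₁ x) (pairedColour h₂ y) (pairedColour h₃ z) ≡ 48
  allDistinct-independent false false false = refl
  allDistinct-independent false false true  = refl
  allDistinct-independent false true  false = refl
  allDistinct-independent false true  true  = refl
  allDistinct-independent true  false false = refl
  allDistinct-independent true  false true  = refl
  allDistinct-independent true  true  false = refl
  allDistinct-independent true  true  true  = refl

  allDistinct-coupled₁₂ : ∀ h₁ h₃ →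
    ∑[ z < 6 ] ∑[ x < 6 ] allDistinct (pairedColour h₁ x) (pairedColour (not h₁) x) (pairedColour h₃ z) ≡ 12
  allDistinct-coupled₁₂ false false = refl
  allDistinct-coupled₁₂ false true  = refl
  allDistinct-coupled₁₂ true  false = refl
  allDistinct-coupled₁₂ true  true  = refl

  allDistinct-coupled₁₃ : ∀ h₁ h₂ →
    ∑[ y < 6 ] ∑[ x < 6 ] allDistinct (pairedColour h₁ x) (pairedColour h₂ y) (pairedColour (not h₁) x) ≡ 12
  allDistinct-coupled₁₃ false false = refl
  allDistinct-coupled₁₃ false true  = refl
  allDistinct-coupled₁₃ true  false = refl
  allDistinct-coupled₁₃ true  true  = refl

  allDistinct-coupled₂₃ : ∀ h₁ h₂ →
    ∑[ y < 6 ] ∑[ x < 6 ] allDistinct (pairedColour h₁ x) (pairedColour h₂ y) (pairedColour (not h₂) y) ≡ 12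
  allDistinct-coupled₂₃ false false = refl
  allDistinct-coupled₂₃ false true  = refl
  allDistinct-coupled₂₃ true  false = refl
  allDistinct-coupled₂₃ true  true  = refl

  outsideCount : Bool → Bool → Bool → ℕ
  outsideCount a b c = 𝟙 (not a) + 𝟙 (not b) + 𝟙 (not c)

  sideColour : Bool → Fin 6 → Fin 3
  sideColour false _  = 0F
  sideColour true  0F = 1F
  sideColour true  1F = 2F
  sideColour true  2F = 1F
  sideColour true  3F = 2F
  sideColour true  4F = 1F
  sideColour true  5F = 2F

  allDistinct-sides : ∀ a b c →
    108 * 𝟙 (does (outsideCount a b c ℕ.≟ 1))
      ≤ ∑[ z < 6 ] ∑[ y < 6 ] ∑[ x < 6 ] allDistinct (sideColour a x) (sideColour b y) (sideColour c z)
  allDistinct-sides false false false = z≤n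
  allDistinct-sides false false true  = z≤n
  allDistinct-sides false true  false = z≤n
  allDistinct-sides false true  true  = ≤-refl
  allDistinct-sides true  false false = z≤n
  allDistinct-sides true  false true  = ≤-refl
  allDistinct-sides true  true  false = ≤-refl
  allDistinct-sides true  true  true  = z≤n

  edge-v₁≢v₂ : ∀ {n} (f : Edge n) → v₁ f ≢ v₂ f
  edge-v₁≢v₂ f = FinP.<⇒≢ (v₁<v₂ f)

  edge-v₂≢v₃ : ∀ {n} (f : Edge n) → v₂ f ≢ v₃ f
  edge-v₂≢v₃ f = FinP.<⇒≢ (v₂<v₃ f)

  edge-v₁≢v₃ : ∀ {n} (f : Edge n) → v₁ f ≢ v₃ f
  edge-v₁≢v₃ f = FinP.<⇒≢ (FinP.<-trans (v₁<v₂ f) (v₂<v₃ f))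

  module Coupled {n L : ℕ} (h : Fin n → Bool) (κ : Fin n → Fin L)
                (separated : ∀ {x y} → κ x ≡ κ y → h x ≡ h y → x ≡ y) where

    coupled-flag : ∀ {x y} → x ≢ y → κ x ≡ κ y → h y ≡ not (h x)
    coupled-flag x≢y κx≡κy = ¬-not (λ hy≡hx → x≢y (separated κx≡κy (sym hy≡hx)))

    no-triple-key : ∀ {x y z} → x ≢ y → x ≢ z → y ≢ z → κ x ≡ κ y → κ x ≢ κ z
    no-triple-key x≢y x≢z y≢z κx≡κy κx≡κz =
      y≢z (separated (trans (sym κx≡κy) κx≡κz) (trans (coupled-flag x≢y κx≡κy) (sym (coupled-flag x≢z κx≡κz))))

    seedCount-independent : ∀ f → κ (v₁ f) ≢ κ (v₂ f) → κ (v₁ f) ≢ κ (v₃ f) → κ (v₂ f) ≢ κ (v₃ f) →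
                            216 * seedCount (λ v → pairedColour (h v)) κ f ≡ 6 ^ L * 48
    seedCount-independent f κ₁≢κ₂ κ₁≢κ₃ κ₂≢κ₃ =
      trans (seedCount-distinct (λ v → pairedColour (h v)) κ f κ₁≢κ₂ κ₁≢κ₃ κ₂≢κ₃)
            (cong (6 ^ L *_) (allDistinct-independent (h (v₁ f)) (h (v₂ f)) (h (v₃ f))))

    private
      216*-from-36* : ∀ w → 6 * (6 * w) ≡ 6 ^ L * 12 → 216 * w ≡ 6 ^ L * 72
      216*-from-36* w 36w≡ = trans (regroup w) (trans (cong (_* 6) 36w≡) (scale (6 ^ L)))
        where
        regroup : ∀ w → 216 * w ≡ 6 * (6 * w) * 6
        regroup = solve-∀
        scale : ∀ X → X * 12 * 6 ≡ X * 72
        scale = solve-∀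

    seedCount-coupled₁₂ : ∀ f → κ (v₁ f) ≡ κ (v₂ f) → 216 * seedCount (λ v → pairedColour (h v)) κ f ≡ 6 ^ L * 72
    seedCount-coupled₁₂ f κ₁≡κ₂ = 216*-from-36* (seedCount (λ v → pairedColour (h v)) κ f) (trans
      (seedCount-shared₁₂ (λ v → pairedColour (h v)) κ f κ₁≡κ₂
                          (no-triple-key (edge-v₁≢v₂ f) (edge-v₁≢v₃ f) (edge-v₂≢v₃ f) κ₁≡κ₂))
      (cong (6 ^ L *_) (subst (λ h₂ → ∑[ z < 6 ] ∑[ x < 6 ]
                                         allDistinct (pairedColour (h (v₁ f)) x) (pairedColour h₂ x) (pairedColour (h (v₃ f)) z) ≡ 12)
                              (sym (coupled-flag (edge-v₁≢v₂ f) κ₁≡κ₂)) (allDistinct-coupled₁₂ (h (v₁ f)) (h (v₃ f))))))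

    seedCount-coupled₁₃ : ∀ f → κ (v₁ f) ≡ κ (v₃ f) → 216 * seedCount (λ v → pairedColour (h v)) κ f ≡ 6 ^ L * 72
    seedCount-coupled₁₃ f κ₁≡κ₃ = 216*-from-36* (seedCount (λ v → pairedColour (h v)) κ f) (trans
      (seedCount-shared₁₃ (λ v → pairedColour (h v)) κ f κ₁≡κ₃
                          (no-triple-key (edge-v₁≢v₃ f) (edge-v₁≢v₂ f) (edge-v₂≢v₃ f ∘ sym) κ₁≡κ₃))
      (cong (6 ^ L *_) (subst (λ h₃ → ∑[ y < 6 ] ∑[ x < 6 ]
                                         allDistinct (pairedColour (h (v₁ f)) x) (pairedColour (h (v₂ f)) y) (pairedColour h₃ x) ≡ 12)
                              (sym (coupled-flag (edge-v₁≢v₃ f) κ₁≡κ₃)) (allDistinct-coupled₁₃ (h (v₁ f)) (h (v₂ f))))))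

    seedCount-coupled₂₃ : ∀ f → κ (v₂ f) ≡ κ (v₃ f) → 216 * seedCount (λ v → pairedColour (h v)) κ f ≡ 6 ^ L * 72
    seedCount-coupled₂₃ f κ₂≡κ₃ = 216*-from-36* (seedCount (λ v → pairedColour (h v)) κ f) (trans
      (seedCount-shared₂₃ (λ v → pairedColour (h v)) κ f κ₂≡κ₃
                          (no-triple-key (edge-v₂≢v₃ f) (edge-v₁≢v₂ f ∘ sym) (edge-v₁≢v₃ f ∘ sym) κ₂≡κ₃ ∘ sym))
      (cong (6 ^ L *_) (subst (λ h₃ → ∑[ y < 6 ] ∑[ x < 6 ]
                                         allDistinct (pairedColour (h (v₁ f)) x) (pairedColour (h (v₂ f)) y) (pairedColour h₃ y) ≡ 12)
                              (sym (coupled-flag (edge-v₂≢v₃ f) κ₂≡κ₃)) (allDistinct-coupled₂₃ (h (v₁ f)) (h (v₂ f))))))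

    private
      48≤72 : ∀ {w} → w ≡ 6 ^ L * 72 → 6 ^ L * 48 ≤ w
      48≤72 refl = *-monoʳ-≤ (6 ^ L) (ℕ.m≤m+n 48 24)

    seedCount-≥ : ∀ f → 6 ^ L * 48 ≤ 216 * seedCount (λ v → pairedColour (h v)) κ f
    seedCount-≥ f with κ (v₁ f) ≟ κ (v₂ f) | κ (v₁ f) ≟ κ (v₃ f) | κ (v₂ f) ≟ κ (v₃ f)
    ... | yes κ₁≡κ₂ | _          | _          = 48≤72 (seedCount-coupled₁₂ f κ₁≡κ₂)
    ... | no _      | yes κ₁≡κ₃ | _          = 48≤72 (seedCount-coupled₁₃ f κ₁≡κ₃)
    ... | no _      | no _       | yes κ₂≡κ₃ = 48≤72 (seedCount-coupled₂₃ f κ₂≡κ₃)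
    ... | no κ₁≢κ₂  | no κ₁≢κ₃   | no κ₂≢κ₃  = ℕ.≤-reflexive (sym (seedCount-independent f κ₁≢κ₂ κ₁≢κ₃ κ₂≢κ₃))

  -- Ranks and the anti-diagonal matching

  rank : ∀ {n} → Subset n → Fin n → ℕ
  rank (_ ∷ U) zero    = 0
  rank (s ∷ U) (suc v) = 𝟙 (not s) + rank U v

  rank<∣∁∣ : ∀ {n} (U : Subset n) {v} → v ∉ U → rank U v < ∣ ∁ U ∣
  rank<∣∁∣ (true  ∷ U) {zero}  v∉U = contradiction here v∉U
  rank<∣∁∣ (false ∷ U) {zero}  _   = s≤s z≤n
  rank<∣∁∣ (true  ∷ U) {suc v} v∉U = rank<∣∁∣ U (v∉U ∘ there)
  rank<∣∁∣ (false ∷ U) {suc v} v∉U = s≤s (rank<∣∁∣ U (v∉U ∘ there))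

  rank-strictMono : ∀ {n} (U : Subset n) {x y} → x Fin.< y → x ∉ U → rank U x < rank U y
  rank-strictMono (true  ∷ U) {zero}          _         x∉U = contradiction here x∉U
  rank-strictMono (false ∷ U) {zero}  {suc y} _         _   = s≤s z≤n
  rank-strictMono (true  ∷ U) {suc x} {suc y} (s≤s x<y) x∉U = rank-strictMono U x<y (x∉U ∘ there)
  rank-strictMono (false ∷ U) {suc x} {suc y} (s≤s x<y) x∉U = s≤s (rank-strictMono U x<y (x∉U ∘ there))

  rank-injective : ∀ {n} (U : Subset n) {x y} → x ∉ U → y ∉ U → rank U x ≡ rank U y → x ≡ y
  rank-injective U {x} {y} x∉U y∉U rx≡ry with FinP.<-cmp x y
  ... | tri< x<y _ _ = contradiction rx≡ry (ℕ.<⇒≢ (rank-strictMono U x<y x∉U))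
  ... | tri≈ _ x≡y _ = x≡y
  ... | tri> _ _ y<x = contradiction (sym rx≡ry) (ℕ.<⇒≢ (rank-strictMono U y<x y∉U))

  -- The vertices outside U are matched along the anti-diagonal r + s = t of their ranks; the two
  -- vertices of a matched pair share a seed and get its low and high colour, all others get a seed of their own.
  data Role (b t r : ℕ) : Set where
    lower  : r < t ∸ r → t ∸ r < b → Role b t r
    upper  : t ∸ r < r → r ≤ t → Role b t r
    single : ¬ (r < t ∸ r × t ∸ r < b) → ¬ (t ∸ r < r × r ≤ t) → Role b t r

  role : ∀ b t r → Role b t r
  role b t r with (r <? t ∸ r) ×-dec (t ∸ r <? b)
  ... | yes (r<t∸r , t∸r<b) = lower r<t∸r t∸r<b
  ... | no  ¬lower with (t ∸ r <? r) ×-dec (r ≤? t)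
  ...   | yes (t∸r<r , r≤t) = upper t∸r<r r≤t
  ...   | no  ¬upper        = single ¬lower ¬upper

  module AntiDiagonal {n : ℕ} (U : Subset n) (t : ℕ) where

    Slot : Set
    Slot = Bool × (Fin n ⊎ Fin n)

    private
      rank<n : ∀ {v} → v ∉ U → rank U v < n
      rank<n v∉U = ℕ.<-≤-trans (rank<∣∁∣ U v∉U) (∣p∣≤n (∁ U))

    slotOutside : ∀ v → v ∉ U → Role ∣ ∁ U ∣ t (rank U v) → Slot
    slotOutside v v∉U (lower _ _)     = false , inj₂ (Fin.fromℕ< (rank<n v∉U))
    slotOutside v v∉U (upper t∸r<r _) = true  , inj₂ (Fin.fromℕ< (ℕ.<-trans t∸r<r (rank<n v∉U)))
    slotOutside v v∉U (single _ _)    = false , inj₁ v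

    slotFrom : ∀ v → Dec (v ∈ U) → Slot
    slotFrom v (yes _)  = false , inj₁ v
    slotFrom v (no v∉U) = slotOutside v v∉U (role ∣ ∁ U ∣ t (rank U v))

    slot : Fin n → Slot
    slot v = slotFrom v (v ∈? U)

    flag : Fin n → Bool
    flag v = proj₁ (slot v)

    key : Fin n → Fin (n + n)
    key v = Fin.join n n (proj₂ (slot v))

    pairRank : Bool → Fin n → ℕ
    pairRank false k = toℕ k
    pairRank true  k = t ∸ toℕ k

    slot-single : ∀ {x h w} → slot x ≡ (h , inj₁ w) → x ≡ w
    slot-single {x} = fromDec (x ∈? U)
      where
      fromRole : ∀ {x∉U h w} r → slotOutside x x∉U r ≡ (h , inj₁ w) → x ≡ w
      fromRole (single _ _) refl = refl
      fromDec : ∀ {h w} d → slotFrom x d ≡ (h , inj₁ w) → x ≡ w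
      fromDec (yes _)  refl = refl
      fromDec (no x∉U) eq   = fromRole (role ∣ ∁ U ∣ t (rank U x)) eq

    slot-pair : ∀ {x h k} → slot x ≡ (h , inj₂ k) → x ∉ U × rank U x ≡ pairRank h k
    slot-pair {x} = fromDec (x ∈? U)
      where
      fromRole : ∀ {x∉U h k} r → slotOutside x x∉U r ≡ (h , inj₂ k) → rank U x ≡ pairRank h k
      fromRole (lower _ _)   refl = sym (FinP.toℕ-fromℕ< _)
      fromRole (upper _ r≤t) refl = sym (trans (cong (t ∸_) (FinP.toℕ-fromℕ< {m = t ∸ rank U x} _)) (ℕ.m∸[m∸n]≡n r≤t))
      fromDec : ∀ {h k} d → slotFrom x d ≡ (h , inj₂ k) → x ∉ U × rank U x ≡ pairRank h k
      fromDec (no x∉U) eq = x∉U , fromRole (role ∣ ∁ U ∣ t (rank U x)) eq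

    slot-injective : ∀ {x y} → slot x ≡ slot y → x ≡ y
    slot-injective {x} {y} sx≡sy with slot x in sx
    ... | h , inj₁ w = trans (slot-single sx) (sym (slot-single (sym sx≡sy)))
    ... | h , inj₂ k with slot-pair sx | slot-pair (sym sx≡sy)
    ...   | x∉U , rx≡ | y∉U , ry≡ = rank-injective U x∉U y∉U (trans rx≡ (sym ry≡))

    separated : ∀ {x y} → key x ≡ key y → flag x ≡ flag y → x ≡ y
    separated kx≡ky fx≡fy = slot-injective (cong₂ _,_ fx≡fy (join-injective kx≡ky))
      where
      join-injective : ∀ {i j} → Fin.join n n i ≡ Fin.join n n j → i ≡ j
      join-injective {i} {j} eq =
        trans (sym (FinP.splitAt-join n n i)) (trans (cong (Fin.splitAt n) eq) (FinP.splitAt-join n n j))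

    private
      slot-lower : ∀ {x} (x∉U : x ∉ U) → rank U x < t ∸ rank U x → t ∸ rank U x < ∣ ∁ U ∣ →
                   proj₂ (slot x) ≡ inj₂ (Fin.fromℕ< (rank<n x∉U))
      slot-lower {x} x∉U r<t∸r t∸r<b = fromDec (x ∈? U)
        where
        fromRole : ∀ {x∉U′} r → proj₂ (slotOutside x x∉U′ r) ≡ inj₂ (Fin.fromℕ< (rank<n x∉U))
        fromRole (lower _ _)       = refl
        fromRole (upper t∸r<r _)   = contradiction r<t∸r (ℕ.<-asym t∸r<r)
        fromRole (single ¬lower _) = contradiction (r<t∸r , t∸r<b) ¬lower
        fromDec : ∀ d → proj₂ (slotFrom x d) ≡ inj₂ (Fin.fromℕ< (rank<n x∉U))
        fromDec (yes x∈U) = contradiction x∈U x∉U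
        fromDec (no _)    = fromRole (role ∣ ∁ U ∣ t (rank U x))

      slot-upper : ∀ {x} (x∉U : x ∉ U) (t∸r<r : t ∸ rank U x < rank U x) → rank U x ≤ t →
                   proj₂ (slot x) ≡ inj₂ (Fin.fromℕ< (ℕ.<-trans t∸r<r (rank<n x∉U)))
      slot-upper {x} x∉U t∸r<r r≤t = fromDec (x ∈? U)
        where
        fromRole : ∀ {x∉U′} r → proj₂ (slotOutside x x∉U′ r) ≡ inj₂ (Fin.fromℕ< (ℕ.<-trans t∸r<r (rank<n x∉U)))
        fromRole (lower r<t∸r _)   = contradiction r<t∸r (ℕ.<-asym t∸r<r)
        fromRole (upper _ _)       = refl
        fromRole (single _ ¬upper) = contradiction (t∸r<r , r≤t) ¬upper
        fromDec : ∀ d → proj₂ (slotFrom x d) ≡ inj₂ (Fin.fromℕ< (ℕ.<-trans t∸r<r (rank<n x∉U)))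
        fromDec (yes x∈U) = contradiction x∈U x∉U
        fromDec (no _)    = fromRole (role ∣ ∁ U ∣ t (rank U x))

    partners-share-key : ∀ {x y} → x ∉ U → y ∉ U → x Fin.< y → t ≡ rank U x + rank U y → key x ≡ key y
    partners-share-key {x} {y} x∉U y∉U x<y t≡rx+ry = cong (Fin.join n n) (begin
      proj₂ (slot x)                                              ≡⟨ slot-lower x∉U rx<t∸rx t∸rx<b ⟩
      inj₂ (Fin.fromℕ< (rank<n x∉U))                             ≡⟨ cong inj₂ (FinP.fromℕ<-cong _ _ (sym t∸ry≡rx) _ _) ⟩
      inj₂ (Fin.fromℕ< (ℕ.<-trans t∸ry<ry (rank<n y∉U)))         ≡⟨ sym (slot-upper y∉U t∸ry<ry ry≤t) ⟩
      proj₂ (slot y)                                              ∎)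
      where
      open ≡-Reasoning
      rx = rank U x
      ry = rank U y
      rx<ry : rx < ry
      rx<ry = rank-strictMono U x<y x∉U
      t∸rx≡ry : t ∸ rx ≡ ry
      t∸rx≡ry = trans (cong (_∸ rx) t≡rx+ry) (ℕ.m+n∸m≡n rx ry)
      t∸ry≡rx : t ∸ ry ≡ rx
      t∸ry≡rx = trans (cong (_∸ ry) t≡rx+ry) (ℕ.m+n∸n≡m rx ry)
      rx<t∸rx : rx < t ∸ rx
      rx<t∸rx = subst (rx <_) (sym t∸rx≡ry) rx<ry
      t∸rx<b : t ∸ rx < ∣ ∁ U ∣
      t∸rx<b = subst (_< ∣ ∁ U ∣) (sym t∸rx≡ry) (rank<∣∁∣ U y∉U)
      t∸ry<ry : t ∸ ry < ry
      t∸ry<ry = subst (_< ry) (sym t∸ry≡rx) rx<ry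
      ry≤t : ry ≤ t
      ry≤t = subst (ry ≤_) (sym t≡rx+ry) (ℕ.m≤n+m ry rx)

  -- Classes of edges and the two colourings

  module EdgeClasses {n : ℕ} (U : Subset n) where

    inside : Fin n → Bool
    inside v = does (v ∈? U)

    outside : Edge n → ℕ
    outside f = outsideCount (inside (v₁ f)) (inside (v₂ f)) (inside (v₃ f))

    oneOutside? : Decidable (λ f → outside f ≡ 1)
    oneOutside? f = outside f ℕ.≟ 1

    twoOutside? : Decidable (λ f → 2 ≤ outside f)
    twoOutside? f = 2 ≤? outside f

    oneOutside twoOutside : Hypergraph n → ℕ
    oneOutside H = length (filter oneOutside? H)
    twoOutside H = length (filter twoOutside? H)

    e-partition : ∀ H → e H ≡ e (induced H U) + oneOutside H + twoOutside H
    e-partition [] = refl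
    e-partition (f ∷ H) = begin
      suc (e H)                             ≡⟨ cong suc (e-partition H) ⟩
      1 + (m₀ + m₁ + m₂)                    ≡⟨ cong (_+ (m₀ + m₁ + m₂)) (sym (classes (inside (v₁ f)) (inside (v₂ f)) (inside (v₃ f)))) ⟩
      (i₀ + i₁ + i₂) + (m₀ + m₁ + m₂)       ≡⟨ regroup i₀ i₁ i₂ m₀ m₁ m₂ ⟩
      (i₀ + m₀) + (i₁ + m₁) + (i₂ + m₂)     ≡⟨ sym (cong₂ _+_ (cong₂ _+_ (length-filter-∷ inU? f H) (length-filter-∷ oneOutside? f H))
                                                             (length-filter-∷ twoOutside? f H)) ⟩
      e (induced (f ∷ H) U) + oneOutside (f ∷ H) + twoOutside (f ∷ H) ∎
      where
      open ≡-Reasoning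
      inU? = λ (f : Edge n) → (v₁ f ∈? U) ×-dec ((v₂ f ∈? U) ×-dec (v₃ f ∈? U))
      m₀ = e (induced H U)
      m₁ = oneOutside H
      m₂ = twoOutside H
      i₀ = 𝟙 (does (inU? f))
      i₁ = 𝟙 (does (oneOutside? f))
      i₂ = 𝟙 (does (twoOutside? f))
      classes : ∀ a b c → 𝟙 (a ∧ (b ∧ c)) + 𝟙 (does (outsideCount a b c ℕ.≟ 1)) + 𝟙 (does (2 ≤? outsideCount a b c)) ≡ 1
      classes false false false = refl
      classes false false true  = refl
      classes false true  false = refl
      classes false true  true  = refl
      classes true  false false = refl
      classes true  false true  = refl
      classes true  true  false = refl
      classes true  true  true  = refl
      regroup : ∀ a b c x y z → (a + b + c) + (x + y + z) ≡ (a + x) + (b + y) + (c + z)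
      regroup = solve-∀

    two-outside-pair : ∀ f → 2 ≤ outside f →
      (v₁ f ∉ U × v₂ f ∉ U) ⊎ (v₁ f ∉ U × v₃ f ∉ U) ⊎ (v₂ f ∉ U × v₃ f ∉ U)
    two-outside-pair f 2≤out with v₁ f ∈? U | v₂ f ∈? U | v₃ f ∈? U
    ... | no v₁∉U | no v₂∉U | _       = inj₁ (v₁∉U , v₂∉U)
    ... | no v₁∉U | yes _   | no v₃∉U = inj₂ (inj₁ (v₁∉U , v₃∉U))
    ... | yes _   | no v₂∉U | no v₃∉U = inj₂ (inj₂ (v₂∉U , v₃∉U))
    ... | no _    | yes _   | yes _   = contradiction 2≤out λ { (s≤s ()) }
    ... | yes _   | no _    | yes _   = contradiction 2≤out λ { (s≤s ()) }
    ... | yes _   | yes _   | no _    = contradiction 2≤out λ { (s≤s ()) }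
    ... | yes _   | yes _   | yes _   = contradiction 2≤out λ ()

    induced-full : ∣ ∁ U ∣ ≡ 0 → ∀ H → induced H U ≡ H
    induced-full ∣∁U∣≡0 H = filter-all _ (All.universal (λ f → ∈U (v₁ f) , ∈U (v₂ f) , ∈U (v₃ f)) H)
      where
      ∈U : ∀ v → v ∈ U
      ∈U v with v ∈? U
      ... | yes v∈U = v∈U
      ... | no  v∉U = contradiction (subst (rank U v <_) ∣∁U∣≡0 (rank<∣∁∣ U v∉U)) ℕ.n≮0

  module Sides {n : ℕ} (U : Subset n) where
    open EdgeClasses U

    sidesColouring : Fin 1 → Vec (Fin 6) n → Cut3 n
    sidesColouring _ = seeded (λ v → sideColour (inside v)) (λ v → v)

    sides-cutCount : ∀ f → 0 + 6 ^ n * 108 * 𝟙 (does (oneOutside? f)) ≤ 216 * cutCount sidesColouring f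
    sides-cutCount f = begin
      6 ^ n * 108 * 𝟙 (does (oneOutside? f))
        ≡⟨ ℕ.*-assoc (6 ^ n) 108 _ ⟩
      6 ^ n * (108 * 𝟙 (does (oneOutside? f)))
        ≤⟨ *-monoʳ-≤ (6 ^ n) (allDistinct-sides (inside (v₁ f)) (inside (v₂ f)) (inside (v₃ f))) ⟩
      6 ^ n * ∑[ z < 6 ] ∑[ y < 6 ] ∑[ x < 6 ]
                allDistinct (sideColour (inside (v₁ f)) x) (sideColour (inside (v₂ f)) y) (sideColour (inside (v₃ f)) z)
        ≡⟨ sym (seedCount-distinct (λ v → sideColour (inside v)) (λ v → v) f
                                   (edge-v₁≢v₂ f) (edge-v₁≢v₃ f) (edge-v₂≢v₃ f)) ⟩
      216 * seedCount (λ v → sideColour (inside v)) (λ v → v) f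
        ≡⟨ cong (216 *_) (sym (+-identityʳ (seedCount (λ v → sideColour (inside v)) (λ v → v) f))) ⟩
      216 * cutCount sidesColouring f ∎
      where open ℕ.≤-Reasoning

    sides-cut : ∀ H → ∃ λ φ → 108 * oneOutside H ≤ 216 * cutSize H φ
    sides-cut H = cut-≥-average sidesColouring H 216 bound
      where
      regroup : ∀ x m → 1 * x * (108 * m) ≡ x * 108 * m
      regroup = solve-∀
      bound : 1 * 6 ^ n * (108 * oneOutside H) ≤ 216 * totalCutSize sidesColouring H
      bound = ℕ.≤-trans (ℕ.≤-reflexive (regroup (6 ^ n) (oneOutside H)))
                        (first-moment sidesColouring oneOutside? 0 (6 ^ n * 108) 216 sides-cutCount H)

  module Pairings {n : ℕ} (U : Subset n) (b′ : ℕ) (∣∁U∣≡1+b′ : ∣ ∁ U ∣ ≡ suc b′) where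
    open EdgeClasses U

    T : ℕ
    T = suc b′ + suc b′

    module Matching (t : Fin T) = AntiDiagonal U (toℕ t)
    module Coupling (t : Fin T) = Coupled (Matching.flag t) (Matching.key t) (Matching.separated t)

    pairingColouring : Fin T → Vec (Fin 6) (n + n) → Cut3 n
    pairingColouring t = seeded (λ v → pairedColour (Matching.flag t v)) (Matching.key t)

    private
      L = n + n
      W : Fin T → Edge n → ℕ
      W t f = 216 * seedCount (λ v → pairedColour (Matching.flag t v)) (Matching.key t) f

      216*cutCount : ∀ f → 216 * cutCount pairingColouring f ≡ ∑[ t < T ] W t f
      216*cutCount f = *-distribˡ-sum 216 (λ t → seedCount (λ v → pairedColour (Matching.flag t v)) (Matching.key t) f)

      matched-gain : ∀ f {x y} → x ∉ U → y ∉ U → x Fin.< y →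
                     (∀ t → Matching.key t x ≡ Matching.key t y → W t f ≡ 6 ^ L * 72) →
                     T * (6 ^ L * 48) + 6 ^ L * 24 ≤ ∑[ t < T ] W t f
      matched-gain f {x} {y} x∉U y∉U x<y coupled =
        ∑-≥-bump t₀ (λ t → Coupling.seedCount-≥ t f)
          (ℕ.≤-reflexive (trans (sym (ℕ.*-distribˡ-+ (6 ^ L) 48 24))
            (sym (coupled t₀ (Matching.partners-share-key t₀ x∉U y∉U x<y (FinP.toℕ-fromℕ< rx+ry<T))))))
        where
        rank< : ∀ {v} → v ∉ U → rank U v < suc b′
        rank< v∉U = subst (rank U _ <_) ∣∁U∣≡1+b′ (rank<∣∁∣ U v∉U)
        rx+ry<T : rank U x + rank U y < T
        rx+ry<T = ℕ.+-mono-< (rank< x∉U) (rank< y∉U)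
        t₀ : Fin T
        t₀ = Fin.fromℕ< rx+ry<T

      gain : ∀ f → 2 ≤ outside f → T * (6 ^ L * 48) + 6 ^ L * 24 ≤ ∑[ t < T ] W t f
      gain f 2≤out with two-outside-pair f 2≤out
      ... | inj₁ (v₁∉U , v₂∉U) =
        matched-gain f v₁∉U v₂∉U (v₁<v₂ f) (λ t → Coupling.seedCount-coupled₁₂ t f)
      ... | inj₂ (inj₁ (v₁∉U , v₃∉U)) =
        matched-gain f v₁∉U v₃∉U (FinP.<-trans (v₁<v₂ f) (v₂<v₃ f)) (λ t → Coupling.seedCount-coupled₁₃ t f)
      ... | inj₂ (inj₂ (v₂∉U , v₃∉U)) =
        matched-gain f v₂∉U v₃∉U (v₂<v₃ f) (λ t → Coupling.seedCount-coupled₂₃ t f)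

    pairing-cutCount : ∀ f → T * (6 ^ L * 48) + 6 ^ L * 24 * 𝟙 (does (twoOutside? f)) ≤ 216 * cutCount pairingColouring f
    pairing-cutCount f = ℕ.≤-trans (bound (twoOutside? f)) (ℕ.≤-reflexive (sym (216*cutCount f)))
      where
      bound : (d : Dec (2 ≤ outside f)) → T * (6 ^ L * 48) + 6 ^ L * 24 * 𝟙 (does d) ≤ ∑[ t < T ] W t f
      bound (yes 2≤out) = ℕ.≤-trans (ℕ.≤-reflexive (cong (T * (6 ^ L * 48) +_) (ℕ.*-identityʳ (6 ^ L * 24)))) (gain f 2≤out)
      bound (no _)      = ℕ.≤-trans (ℕ.≤-reflexive (trans (cong (T * (6 ^ L * 48) +_) (ℕ.*-zeroʳ (6 ^ L * 24)))
                                                          (+-identityʳ (T * (6 ^ L * 48)))))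
                                    (∑-≥ (λ t → Coupling.seedCount-≥ t f))

    pairing-cut : ∀ H → ∃ λ φ → 48 * T * e H + 24 * twoOutside H ≤ 216 * T * cutSize H φ
    pairing-cut H = cut-≥-average pairingColouring H (216 * T) bound
      where
      regroup : ∀ T x m m₂ → T * x * (48 * T * m + 24 * m₂) ≡ T * (T * (x * 48) * m + x * 24 * m₂)
      regroup = solve-∀
      reorder : ∀ T c → T * (216 * c) ≡ 216 * T * c
      reorder = solve-∀
      bound : T * 6 ^ L * (48 * T * e H + 24 * twoOutside H) ≤ 216 * T * totalCutSize pairingColouring H
      bound = begin
        T * 6 ^ L * (48 * T * e H + 24 * twoOutside H)
          ≡⟨ regroup T (6 ^ L) (e H) (length (filter twoOutside? H)) ⟩
        T * (T * (6 ^ L * 48) * e H + 6 ^ L * 24 * length (filter twoOutside? H))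
          ≤⟨ *-monoʳ-≤ T (first-moment pairingColouring twoOutside? (T * (6 ^ L * 48)) (6 ^ L * 24) 216 pairing-cutCount H) ⟩
        T * (216 * totalCutSize pairingColouring H)
          ≡⟨ reorder T (totalCutSize pairingColouring H) ⟩
        216 * T * totalCutSize pairingColouring H ∎
        where open ℕ.≤-Reasoning

  sides-arith : ∀ {m m₁ B cut} → 1 ≤ B → m ≤ 2 * m₁ → 108 * m₁ ≤ 216 * cut →
                27 * m + 240 * B * m ≤ 1080 * B * cut
  sides-arith {m} {m₁} {B} {cut} 1≤B m≤2m₁ m₁≤2cut = begin
    27 * m + 240 * B * m         ≤⟨ ℕ.+-monoˡ-≤ (240 * B * m) (ℕ.*-monoˡ-≤ m 27≤30B) ⟩
    30 * B * m + 240 * B * m     ≡⟨ regroup B m ⟩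
    5 * B * (27 * (2 * m))       ≤⟨ ℕ.*-monoʳ-≤ (5 * B) (ℕ.*-monoʳ-≤ 27 (ℕ.*-monoʳ-≤ 2 m≤2m₁)) ⟩
    5 * B * (27 * (2 * (2 * m₁))) ≡⟨ cong (5 * B *_) (four m₁) ⟩
    5 * B * (108 * m₁)           ≤⟨ ℕ.*-monoʳ-≤ (5 * B) m₁≤2cut ⟩
    5 * B * (216 * cut)          ≡⟨ scale B cut ⟩
    1080 * B * cut               ∎
    where
    open ℕ.≤-Reasoning
    27≤30B : 27 ≤ 30 * B
    27≤30B = ℕ.≤-trans (ℕ.m≤m+n 27 3) (ℕ.*-monoʳ-≤ 30 1≤B)
    regroup : ∀ B m → 30 * B * m + 240 * B * m ≡ 5 * B * (27 * (2 * m))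
    regroup = solve-∀
    four : ∀ x → 27 * (2 * (2 * x)) ≡ 108 * x
    four = solve-∀
    scale : ∀ B c → 5 * B * (216 * c) ≡ 1080 * B * c
    scale = solve-∀

  last-part-large : ∀ {m m₀ m₁ m₂} → m ≡ m₀ + m₁ + m₂ → 40 * m₀ < m → 2 * m₁ < m → 38 * m ≤ 80 * m₂
  last-part-large {m} {m₀} {m₁} {m₂} m≡ 40m₀<m 2m₁<m = ℕ.+-cancelˡ-≤ (42 * m) _ _ (begin
    42 * m + 38 * m                           ≡⟨ split m ⟩
    80 * m                                    ≡⟨ cong (80 *_) m≡ ⟩
    80 * (m₀ + m₁ + m₂)                       ≡⟨ expand m₀ m₁ m₂ ⟩
    2 * (40 * m₀) + 40 * (2 * m₁) + 80 * m₂   ≤⟨ ℕ.+-monoˡ-≤ (80 * m₂) (ℕ.+-mono-≤ (ℕ.*-monoʳ-≤ 2 (ℕ.<⇒≤ 40m₀<m))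
                                                                               (ℕ.*-monoʳ-≤ 40 (ℕ.<⇒≤ 2m₁<m))) ⟩
    2 * m + 40 * m + 80 * m₂                  ≡⟨ collect m (80 * m₂) ⟩
    42 * m + 80 * m₂                          ∎)
    where
    open ℕ.≤-Reasoning
    split : ∀ m → 42 * m + 38 * m ≡ 80 * m
    split = solve-∀
    expand : ∀ a b c → 80 * (a + b + c) ≡ 2 * (40 * a) + 40 * (2 * b) + 80 * c
    expand = solve-∀
    collect : ∀ m x → 2 * m + 40 * m + x ≡ 42 * m + x
    collect = solve-∀

  pairing-arith : ∀ {m m₂ B T cut} → T ≡ B + B → 38 * m ≤ 80 * m₂ → 48 * T * m + 24 * m₂ ≤ 216 * T * cut →
                  27 * m + 240 * B * m ≤ 1080 * B * cut
  pairing-arith {m} {m₂} {B} {cut = cut} refl 38m≤80m₂ pairing≤ = ℕ.*-cancelˡ-≤ 4 (begin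
    4 * (27 * m + 240 * B * m)                ≡⟨ expand m B ⟩
    108 * m + 960 * B * m                     ≤⟨ ℕ.+-monoˡ-≤ (960 * B * m) (ℕ.*-monoˡ-≤ m (ℕ.m≤m+n 108 6)) ⟩
    114 * m + 960 * B * m                     ≡⟨ cong (_+ 960 * B * m) (ℕ.*-assoc 3 38 m) ⟩
    3 * (38 * m) + 960 * B * m                ≤⟨ ℕ.+-monoˡ-≤ (960 * B * m) (ℕ.*-monoʳ-≤ 3 38m≤80m₂) ⟩
    3 * (80 * m₂) + 960 * B * m               ≡⟨ regroup m B m₂ ⟩
    10 * (48 * (B + B) * m + 24 * m₂)         ≤⟨ ℕ.*-monoʳ-≤ 10 pairing≤ ⟩
    10 * (216 * (B + B) * cut)                ≡⟨ scale B cut ⟩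
    4 * (1080 * B * cut)                      ∎)
    where
    open ℕ.≤-Reasoning
    expand : ∀ m B → 4 * (27 * m + 240 * B * m) ≡ 108 * m + 960 * B * m
    expand = solve-∀
    regroup : ∀ m B m₂ → 3 * (80 * m₂) + 960 * B * m ≡ 10 * (48 * (B + B) * m + 24 * m₂)
    regroup = solve-∀
    scale : ∀ B c → 10 * (216 * (B + B) * c) ≡ 4 * (1080 * B * c)
    scale = solve-∀

  1/40 : ℚ
  1/40 = pos 1 ℚ./ 40

  toℚᵘ-/ : ∀ k d → ℚ.toℚᵘ (pos k ℚ./ suc d) ≃ mkℚᵘ (pos k) d
  toℚᵘ-/ k d = ℚP.toℚᵘ-fromℚᵘ (mkℚᵘ (pos k) d)

  ≤-via-toℚᵘ : ∀ {p q p′ q′} → ℚ.toℚᵘ p ≃ p′ → ℚ.toℚᵘ q ≃ q′ → p′ ℚᵘ.≤ q′ → p ℚ.≤ q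
  ≤-via-toℚᵘ p≃p′ q≃q′ p′≤q′ =
    ℚP.toℚᵘ-cancel-≤ (ℚᵘP.≤-respˡ-≃ (ℚᵘP.≃-sym p≃p′) (ℚᵘP.≤-respʳ-≃ (ℚᵘP.≃-sym q≃q′) p′≤q′))

  1/40-≤ : ∀ {m k} → m ≤ 40 * k → 1/40 ℚ.* toℚ m ℚ.≤ toℚ k
  1/40-≤ {m} {k} m≤40k = ≤-via-toℚᵘ lhs≃ (toℚᵘ-/ k 0)
    (*≤* (subst₂ ℤ._≤_ (sym (unit (pos m))) (ℤP.pos-* k 40) (ℤ.+≤+ (subst (m ≤_) (ℕ.*-comm 40 k) m≤40k))))
    where
    lhs≃ : ℚ.toℚᵘ (1/40 ℚ.* toℚ m) ≃ mkℚᵘ (pos 1) 39 ℚᵘ.* mkℚᵘ (pos m) 0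
    lhs≃ = ℚᵘP.≃-trans (ℚP.toℚᵘ-homo-* 1/40 (toℚ m)) (ℚᵘP.*-cong (toℚᵘ-/ 1 39) (toℚᵘ-/ m 0))
    unit : ∀ M → (pos 1 ℤ.* M) ℤ.* pos 1 ≡ M
    unit = ℤ-solve-∀

  1/40-≤-excess : ∀ {m b cut} → 27 * m + 240 * suc b * m ≤ 1080 * suc b * cut →
                  1/40 ℚ.* toℚ m ℚ.* (pos 1 ℚ./ suc b) ℚ.≤ toℚ cut ℚ.- (pos (6 * m)) ℚ./ 27
  1/40-≤-excess {m} {b} {cut} h =
    ≤-via-toℚᵘ lhs≃ rhs≃ (*≤* (subst₂ ℤ._≤_ (sym lhs≡) (sym rhs≡) (ℤ.+≤+ (ℕ.m+n≤o⇒m≤o∸n (27 * m) h))))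
    where
    B = suc b
    lhs≃ : ℚ.toℚᵘ (1/40 ℚ.* toℚ m ℚ.* (pos 1 ℚ./ B)) ≃ (mkℚᵘ (pos 1) 39 ℚᵘ.* mkℚᵘ (pos m) 0) ℚᵘ.* mkℚᵘ (pos 1) b
    lhs≃ = ℚᵘP.≃-trans (ℚP.toℚᵘ-homo-* (1/40 ℚ.* toℚ m) (pos 1 ℚ./ B))
             (ℚᵘP.*-cong (ℚᵘP.≃-trans (ℚP.toℚᵘ-homo-* 1/40 (toℚ m)) (ℚᵘP.*-cong (toℚᵘ-/ 1 39) (toℚᵘ-/ m 0)))
                         (toℚᵘ-/ 1 b))
    rhs≃ : ℚ.toℚᵘ (toℚ cut ℚ.- (pos (6 * m)) ℚ./ 27) ≃ mkℚᵘ (pos cut) 0 ℚᵘ.- mkℚᵘ (pos (6 * m)) 26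
    rhs≃ = ℚᵘP.≃-trans (ℚP.toℚᵘ-homo-+ (toℚ cut) (ℚ.- (pos (6 * m) ℚ./ 27)))
             (ℚᵘP.+-cong (toℚᵘ-/ cut 0)
                         (ℚᵘP.≃-trans (ℚP.toℚᵘ-homo‿- (pos (6 * m) ℚ./ 27)) (ℚᵘP.-‿cong (toℚᵘ-/ (6 * m) 26))))
    -- lhs≡ and rhs≡ rewrite the two cross products that *≤* compares for these unnormalised fractions.
    lhs≡ : ((pos 1 ℤ.* pos m) ℤ.* pos 1) ℤ.* pos 27 ≡ pos (27 * m)
    lhs≡ = trans (ring (pos m)) (sym (ℤP.pos-* 27 m))
      where
      ring : ∀ M → ((pos 1 ℤ.* M) ℤ.* pos 1) ℤ.* pos 27 ≡ pos 27 ℤ.* M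
      ring = ℤ-solve-∀
    rhs≡ : (pos cut ℤ.* pos 27 ℤ.+ (ℤ.- pos (6 * m)) ℤ.* pos 1) ℤ.* pos (40 * B) ≡ pos (1080 * B * cut ∸ 240 * B * m)
    rhs≡ = begin
      (pos cut ℤ.* pos 27 ℤ.+ (ℤ.- pos (6 * m)) ℤ.* pos 1) ℤ.* pos (40 * B)
        ≡⟨ cong₂ (λ x y → (pos cut ℤ.* pos 27 ℤ.+ (ℤ.- x) ℤ.* pos 1) ℤ.* y) (ℤP.pos-* 6 m) (ℤP.pos-* 40 B) ⟩
      (pos cut ℤ.* pos 27 ℤ.+ (ℤ.- (pos 6 ℤ.* pos m)) ℤ.* pos 1) ℤ.* (pos 40 ℤ.* pos B)
        ≡⟨ ring (pos cut) (pos m) (pos B) ⟩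
      pos 1080 ℤ.* pos B ℤ.* pos cut ℤ.- pos 240 ℤ.* pos B ℤ.* pos m
        ≡⟨ sym (cong₂ ℤ._-_ (pos-*₃ 1080 B cut) (pos-*₃ 240 B m)) ⟩
      pos (1080 * B * cut) ℤ.- pos (240 * B * m)
        ≡⟨ ℤP.m-n≡m⊖n (1080 * B * cut) (240 * B * m) ⟩
      1080 * B * cut ℤ.⊖ 240 * B * m
        ≡⟨ ℤP.⊖-≥ (ℕ.m+n≤o⇒n≤o (27 * m) h) ⟩
      pos (1080 * B * cut ∸ 240 * B * m) ∎
      where
      open ≡-Reasoning
      ring : ∀ C M Bz → (C ℤ.* pos 27 ℤ.+ (ℤ.- (pos 6 ℤ.* M)) ℤ.* pos 1) ℤ.* (pos 40 ℤ.* Bz)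
                        ≡ pos 1080 ℤ.* Bz ℤ.* C ℤ.- pos 240 ℤ.* Bz ℤ.* M
      ring = ℤ-solve-∀
      pos-*₃ : ∀ a b c → pos (a * b * c) ≡ pos a ℤ.* pos b ℤ.* pos c
      pos-*₃ a b c = trans (ℤP.pos-* (a * b) c) (cong (ℤ._* pos c) (ℤP.pos-* a b))

  -- Implicit arguments are passed explicitly (and pairing-arith takes T with T ≡ B + B): when it has to
  -- solve them, Agda unfolds products of numerals with suc-headed terms such as 240 * suc b′.
  excess-from-sides : ∀ {n} (U : Subset n) b′ H → e H ≤ 2 * EdgeClasses.oneOutside U H →
    ∃ λ φ → 1/40 ℚ.* toℚ (e H) ℚ.* (pos 1 ℚ./ suc b′) ℚ.≤ excess H φ
  excess-from-sides U b′ H m≤2m₁ = Product.map₂ (λ {φ} ≤cut → 1/40-≤-excess {e H} {b′} {cutSize H φ}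
    (sides-arith {e H} {EdgeClasses.oneOutside U H} {suc b′} {cutSize H φ} (s≤s z≤n) m≤2m₁ ≤cut))
    (Sides.sides-cut U H)

  excess-from-pairing : ∀ {n} (U : Subset n) b′ → ∣ ∁ U ∣ ≡ suc b′ → ∀ H →
    40 * e (induced H U) < e H → 2 * EdgeClasses.oneOutside U H < e H →
    ∃ λ φ → 1/40 ℚ.* toℚ (e H) ℚ.* (pos 1 ℚ./ suc b′) ℚ.≤ excess H φ
  excess-from-pairing U b′ ∣∁U∣≡1+b′ H 40m₀<m 2m₁<m = Product.map₂ (λ {φ} ≤cut → 1/40-≤-excess {e H} {b′} {cutSize H φ}
    (pairing-arith {e H} {EdgeClasses.twoOutside U H} {suc b′} {Pairings.T U b′ ∣∁U∣≡1+b′} {cutSize H φ} refl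
      (last-part-large {e H} {e (induced H U)} {EdgeClasses.oneOutside U H} {EdgeClasses.twoOutside U H}
                       (EdgeClasses.e-partition U H) 40m₀<m 2m₁<m) ≤cut))
    (Pairings.pairing-cut U b′ ∣∁U∣≡1+b′ H)

  ∣∁U∣≡ : ∀ {n b} (U : Subset n) → ∣ U ∣ + b ≡ n → ∣ ∁ U ∣ ≡ b
  ∣∁U∣≡ {n} {b} U ∣U∣+b≡n =
    trans (∣∁p∣≡n∸∣p∣ U) (trans (cong (_∸ ∣ U ∣) (sym ∣U∣+b≡n)) (ℕ.m+n∸m≡n ∣ U ∣ b))

open import Data.Nat using (ℕ; suc; _+_)
import Data.Nat as ℕ
import Data.Nat.Properties as ℕP
open import Relation.Binary.PropositionalEquality using (_≡_; refl; subst; sym)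
open import Data.Fin.Subset using (Subset; ∣_∣)
open import Data.Product using (Σ; ∃; _×_; _,_; _,′_)
open import Data.Sum using (_⊎_; inj₁; inj₂)
open import Data.Rational using (ℚ; _≤_; _*_; Positive)
import Data.Rational as ℚ
open import Data.Integer using (+_)
open import Function using (case_of_)
open import Relation.Nullary using (yes; no)
open Averaging using (1/40; 1/40-≤; ∣∁U∣≡; module EdgeClasses; excess-from-sides; excess-from-pairing)

lemma5p5 : Σ ℚ λ c → Positive c ×
    (∀ (n b : ℕ) (H : Hypergraph n) (U : Subset n) → ∣ U ∣ + b ≡ n →
      (c * toℚ (e H) ≤ toℚ (e (induced H U)))
      ⊎ (∃ λ (b′ : ℕ) → b ≡ suc b′ × ∃ λ (φ : Cut3 n) → c * toℚ (e H) * (+ 1 ℚ./ suc b′) ≤ excess H φ))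
lemma5p5 = 1/40 , _ , λ where
  n ℕ.zero H U ∣U∣+0≡n → inj₁ (subst (λ G → 1/40 * toℚ (e H) ≤ toℚ (e G))
                                      (sym (EdgeClasses.induced-full U (∣∁U∣≡ U ∣U∣+0≡n) H))
                                      (1/40-≤ {e H} {e H} (ℕP.m≤n*m (e H) 40)))
  n (suc b′) H U ∣U∣+b≡n →
    case ((e H ℕ.≤? 40 ℕ.* e (induced H U)) ,′ (e H ℕ.≤? 2 ℕ.* EdgeClasses.oneOutside U H)) of λ where
      (yes m≤40m₀ , _)         → inj₁ (1/40-≤ {e H} {e (induced H U)} m≤40m₀)
      (no _       , yes m≤2m₁) → inj₂ (b′ , refl , excess-from-sides U b′ H m≤2m₁)
      (no m≰40m₀  , no m≰2m₁)  → inj₂ (b′ , refl , excess-from-pairing U b′ (∣∁U∣≡ U ∣U∣+b≡n) H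
                                                                       (ℕP.≰⇒> m≰40m₀) (ℕP.≰⇒> m≰2m₁))
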